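{- Let $C\subseteq\omega$ be a hypersimple set. Then there is a hypersimple set $W\equiv_T C$ with $\underline{\rho}(W)=0$.
   Context: For $A\subseteq\omega$ and $n\geq 1$, $\rho_n(A)=|A\cap\{0,\dots,n-1\}|/n$ and $\underline{\rho}(A)=\liminf_n\rho_n(A)$. A set $X$ is hyperimmune if it is infinite and for every disjoint strong array (a total computable $f$ such that the finite sets $D_{f(n)}$, in the canonical indexing of finite sets, are pairwise disjoint) there is $n$ with $D_{f(n)}\cap X=\emptyset$. A set is hypersimple if it is computably enumerable and its complement is hyperimmune. -}

module Defs where

open import Data.Nat using (ℕ; zero; suc; _+_; _*_; _/_; _%_; _≤_; _<_)
open import Data.Bool using (Bool; true; false; if_then_else_)
open import Data.Fin using (Fin)
open import Data.Vec using (Vec; []; _∷_; lookup)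
open import Data.Product using (Σ; _×_; ∃; ∃-syntax; _,_)
open import Data.Integer using (+_)
open import Data.Rational using (ℚ; 0ℚ) renaming (_<_ to _<ℚ_; _/_ to _/ℚ_)
open import Relation.Binary.PropositionalEquality using (_≡_; _≢_)
open import Relation.Nullary using (¬_)
open import Function.Bundles using (_⇔_)

SetN : Set
SetN = ℕ → Bool

bitVal : Bool → ℕ
bitVal true  = 1
bitVal false = 0

-- Model of computation: μ-recursive functions with an oracle.
-- Code k = programs of arity k.
data Code : ℕ → Set where
  zro  : ∀ {k} → Code k
  sc   : Code 1
  proj : ∀ {k} → Fin k → Code k
  comp : ∀ {m k} → Code m → Vec (Code k) m → Code k
  prec : ∀ {k} → Code k → Code (suc (suc k)) → Code (suc k)
  mu   : ∀ {k} → Code (suc k) → Code k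
  orc  : Code 1

-- Big-step (partial) semantics relative to an oracle X:
-- Eval X c xs y  means  Φ_c^X(xs) converges with output y.
mutual
  data Eval (X : SetN) : ∀ {k} → Code k → Vec ℕ k → ℕ → Set where
    e-zro  : ∀ {k} {xs : Vec ℕ k} → Eval X zro xs 0
    e-sc   : ∀ {x} → Eval X sc (x ∷ []) (suc x)
    e-proj : ∀ {k} {i : Fin k} {xs} → Eval X (proj i) xs (lookup xs i)
    e-comp : ∀ {m k} {f : Code m} {gs : Vec (Code k) m} {xs ys y} →
             EvalAll X xs gs ys → Eval X f ys y → Eval X (comp f gs) xs y
    e-prec0 : ∀ {k} {g : Code k} {h xs y} →
              Eval X g xs y → Eval X (prec g h) (0 ∷ xs) y
    e-precS : ∀ {k} {g : Code k} {h n xs r y} →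
              Eval X (prec g h) (n ∷ xs) r → Eval X h (n ∷ r ∷ xs) y →
              Eval X (prec g h) (suc n ∷ xs) y
    e-mu   : ∀ {k} {f : Code (suc k)} {xs y} →
             Eval X f (y ∷ xs) 0 →
             (∀ z → z < y → Σ ℕ λ v → Eval X f (z ∷ xs) (suc v)) →
             Eval X (mu f) xs y
    e-orc  : ∀ {x} → Eval X orc (x ∷ []) (bitVal (X x))

  data EvalAll (X : SetN) {k : ℕ} (xs : Vec ℕ k) :
         ∀ {m} → Vec (Code k) m → Vec ℕ m → Set where
    ea-[] : EvalAll X xs [] []
    ea-∷  : ∀ {m} {g : Code k} {gs : Vec (Code k) m} {y ys} →
            Eval X g xs y → EvalAll X xs gs ys → EvalAll X xs (g ∷ gs) (y ∷ ys)

∅ : SetN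
∅ _ = false

Computable : (ℕ → ℕ) → Set
Computable f = ∃[ c ] (∀ n → Eval ∅ c (n ∷ []) (f n))

CE : SetN → Set
CE A = ∃[ c ] (∀ x → (A x ≡ true) ⇔ (∃[ y ] Eval ∅ c (x ∷ []) y))

_≤T_ : SetN → SetN → Set
A ≤T B = ∃[ c ] (∀ x → Eval B c (x ∷ []) (bitVal (A x)))

_≡T_ : SetN → SetN → Set
A ≡T B = (A ≤T B) × (B ≤T A)

-- Canonical indexing of finite sets: x ∈ D_n iff bit x of n is 1.
bit : ℕ → ℕ → ℕ
bit n zero    = n % 2
bit n (suc x) = bit (n / 2) x

_∈D_ : ℕ → ℕ → Set
x ∈D n = bit n x ≡ 1

DisjointStrongArray : (ℕ → ℕ) → Set
DisjointStrongArray f =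
  Computable f × (∀ n m → n ≢ m → ∀ x → x ∈D f n → ¬ (x ∈D f m))

Infinite : SetN → Set
Infinite X = ∀ m → ∃[ x ] (m ≤ x × X x ≡ true)

Hyperimmune : SetN → Set
Hyperimmune X =
  Infinite X ×
  (∀ f → DisjointStrongArray f → ∃[ n ] (∀ x → x ∈D f n → X x ≡ false))

complement : SetN → SetN
complement A x = if A x then false else true

Hypersimple : SetN → Set
Hypersimple A = CE A × Hyperimmune (complement A)

count : SetN → ℕ → ℕ
count A zero    = 0
count A (suc n) = bitVal (A n) + count A n

-- ρ_{n+1}(A) as a rational (index shifted so the denominator is nonzero)
ρ-suc : SetN → ℕ → ℚ
ρ-suc A n = (+ count A (suc n)) /ℚ suc n

-- liminf_n ρ_n(A) = 0.  Since ρ_n ≥ 0, this is: for every rational ε > 0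
-- and every N there is n ≥ N with ρ_n(A) < ε.
LowerDensityZero : SetN → Set
LowerDensityZero A = ∀ (ε : ℚ) → 0ℚ <ℚ ε → ∀ N → ∃[ n ] (N ≤ n × ρ-suc A n <ℚ ε)

-- Spread each point y of C over the factorial block [y !, (1+y) !) (with {0} as the block
-- of 0): W x = C (block x).  Since block and its right inverse blockStart are computable,
-- W ≡T C and W is c.e. together with C.  If y ∉ C, the first (1+y) ! numbers contain at
-- most y ! elements of W, so W has density at most 1/(1+y) there, and the complement of C
-- is infinite, so the lower density of W is 0.
--
-- Hyperimmunity of the complement is pulled back along block.  Given a disjoint strong
-- array f, by disjointness and pigeonhole some D_{f m} lies above any bound, so we can
-- effectively pick the first one lying above t !, where t starts at 0 and then jumps
-- past max D_{f m}.  Every x in that set has t ≤ block x ≤ x, so the blocks land in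
-- [t, t′), and these intervals form a disjoint strong array.  One of them misses the
-- complement of C, and then the corresponding D_{f m} misses the complement of W.

module Submission where

open import Defs
open import Data.Bool using (true; false)
open import Data.Empty using (⊥-elim)
open import Data.Fin using (Fin; toℕ; fromℕ<) renaming (zero to fzero; suc to fsuc; _<_ to _<ᶠ_)
open import Data.Fin.Properties using (pigeonhole; toℕ<n; toℕ-fromℕ<)
open import Data.Integer using (-[1+_]; +<+)
import Data.Integer as ℤ
open import Data.Integer.Properties using (pos-*)
open import Data.Nat using (ℕ; zero; suc; _+_; _*_; _∸_; _^_; _!; _≤_; _<_; _≤′_; ≤′-refl; ≤′-step; z≤n; s≤s; pred; NonZero; _/_; _%_; _<?_; _≟_)
open import Data.Nat.Coprimality using (Coprime)
open import Data.Nat.Divisibility using (_∣_; divides; _∣?_; ∣⇒≤; m≤n⇒m!∣n!; m%n≡0⇒n∣m; n∣m⇒m%n≡0)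
open import Data.Nat.DivMod using (m≡m%n+[m/n]*n; m%n<n; m/n*n≤m; m%n≡m∸m/n*n; m*n%n≡0; m*n/n≡m; [m+kn]%n≡m%n; +-distrib-/-∣ʳ; m/n<m)
open import Data.Nat.Induction using (<-rec)
open import Data.Nat.Properties
open import Data.Product using (∃; ∃₂; ∃-syntax; _×_; _,_; proj₁; proj₂; map)
open import Data.Rational using (mkℚ; *<*) renaming (_<_ to _<ℚ_)
open import Data.Rational.Properties using (toℚᵘ-cancel-<; toℚᵘ-fromℚᵘ)
open import Data.Rational.Unnormalised using (mkℚᵘ) renaming (*<* to *<*ᵘ)
open import Data.Rational.Unnormalised.Properties using (<-respˡ-≃; ≃-sym)
open import Data.Sum using (_⊎_; inj₁; inj₂)
open import Data.Vec using (Vec; []; _∷_; lookup; head)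
open import Function using (_∘_)
open import Function.Bundles using (mk⇔; Equivalence)
open import Relation.Binary.Definitions using (tri<; tri≈; tri>)
open import Relation.Binary.PropositionalEquality
open import Relation.Nullary using (¬_; yes; no; contradiction)
open import Relation.Unary using (Decidable)

-- Programs with verified semantics

record Program (X : SetN) (k : ℕ) (F : Vec ℕ k → ℕ) : Set where
  constructor program
  field
    code : Code k
    eval : ∀ xs → Eval X code xs (F xs)
open Program

unary : (ℕ → ℕ) → Vec ℕ 1 → ℕ
unary f xs = f (head xs)

binary : (ℕ → ℕ → ℕ) → Vec ℕ 2 → ℕ
binary f (x ∷ y ∷ []) = f x y

primRec : ∀ {k} → (Vec ℕ k → ℕ) → (Vec ℕ (suc (suc k)) → ℕ) → Vec ℕ (suc k) → ℕ
primRec G H (zero  ∷ xs) = G xs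
primRec G H (suc n ∷ xs) = H (n ∷ primRec G H (n ∷ xs) ∷ xs)

module _ {X : SetN} where

  cast : ∀ {k} {F G : Vec ℕ k → ℕ} → (∀ xs → F xs ≡ G xs) → Program X k F → Program X k G
  cast F≡G (program c ev) = program c (λ xs → subst (Eval X c xs) (F≡G xs) (ev xs))

  zeroᴾ : ∀ {k} → Program X k (λ _ → 0)
  zeroᴾ = program zro (λ _ → e-zro)

  sucᴾ : Program X 1 (unary suc)
  sucᴾ = program sc (λ { (_ ∷ []) → e-sc })

  projᴾ : ∀ {k} (i : Fin k) → Program X k (λ xs → lookup xs i)
  projᴾ i = program (proj i) (λ _ → e-proj)

  x₀ : ∀ {k} → Program X (suc k) (λ xs → lookup xs fzero)
  x₀ = projᴾ fzero

  x₁ : ∀ {k} → Program X (suc (suc k)) (λ xs → lookup xs (fsuc fzero))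
  x₁ = projᴾ (fsuc fzero)

  x₂ : ∀ {k} → Program X (suc (suc (suc k))) (λ xs → lookup xs (fsuc (fsuc fzero)))
  x₂ = projᴾ (fsuc (fsuc fzero))

  comp₁ : ∀ {k F G} → Program X 1 F → Program X k G → Program X k (λ xs → F (G xs ∷ []))
  comp₁ (program f ef) (program g eg) =
    program (comp f (g ∷ [])) (λ xs → e-comp (ea-∷ (eg xs) ea-[]) (ef _))

  comp₂ : ∀ {k F G H} → Program X 2 F → Program X k G → Program X k H →
          Program X k (λ xs → F (G xs ∷ H xs ∷ []))
  comp₂ (program f ef) (program g eg) (program h eh) =
    program (comp f (g ∷ h ∷ [])) (λ xs → e-comp (ea-∷ (eg xs) (ea-∷ (eh xs) ea-[])) (ef _))

  primRecᴾ : ∀ {k G H} → Program X k G → Program X (suc (suc k)) H → Program X (suc k) (primRec G H)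
  primRecᴾ {G = G} {H} (program g eg) (program h eh) = program (prec g h) ev
    where
    ev : ∀ xs → Eval X (prec g h) xs (primRec G H xs)
    ev (zero  ∷ xs) = e-prec0 (eg xs)
    ev (suc n ∷ xs) = e-precS (ev (n ∷ xs)) (eh _)

  minimiseᴾ : ∀ {k T} → Program X (suc k) T → (F : Vec ℕ k → ℕ) →
              (∀ xs → T (F xs ∷ xs) ≡ 0) → (∀ xs {z} → z < F xs → T (z ∷ xs) ≢ 0) →
              Program X k F
  minimiseᴾ {T = T} (program t et) F root below =
    program (mu t) (λ xs → e-mu (subst (Eval X t _) (root xs) (et _)) (positive xs))
    where
    positive : ∀ xs z → z < F xs → ∃ λ v → Eval X t (z ∷ xs) (suc v)
    positive xs z z< with T (z ∷ xs) in eq | et (z ∷ xs)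
    ... | zero  | _ = ⊥-elim (below xs z< eq)
    ... | suc v | e = v , e

toComputable : ∀ {f} → Program ∅ 1 (unary f) → Computable f
toComputable (program c ev) = c , λ n → ev (n ∷ [])

fromComputable : ∀ {f} → Computable f → Program ∅ 1 (unary f)
fromComputable (c , ev) = program c (λ { (n ∷ []) → ev n })

module _ {X : SetN} where

  addᴾ : Program X 2 (binary _+_)
  addᴾ = cast (λ { (n ∷ m ∷ []) → sum n m }) (primRecᴾ x₀ (comp₁ sucᴾ x₁))
    where
    sum : ∀ n m → primRec (λ xs → lookup xs fzero) (λ xs → suc (lookup xs (fsuc fzero)))
                          (n ∷ m ∷ []) ≡ n + m
    sum zero    m = refl
    sum (suc n) m = cong suc (sum n m)

  mulᴾ : Program X 2 (binary _*_)
  mulᴾ = cast (λ { (n ∷ m ∷ []) → product n m }) (primRecᴾ zeroᴾ (comp₂ addᴾ x₂ x₁))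
    where
    product : ∀ n m → primRec (λ _ → 0) (λ xs → lookup xs (fsuc (fsuc fzero)) + lookup xs (fsuc fzero))
                              (n ∷ m ∷ []) ≡ n * m
    product zero    m = refl
    product (suc n) m = cong (m +_) (product n m)

  predᴾ : Program X 1 (unary pred)
  predᴾ = cast (λ { (zero ∷ []) → refl ; (suc n ∷ []) → refl }) (primRecᴾ zeroᴾ x₀)

  monusᴾ : Program X 2 (binary _∸_)
  monusᴾ = cast (λ { (m ∷ n ∷ []) → difference n m }) (comp₂ (primRecᴾ x₀ (comp₁ predᴾ x₁)) x₁ x₀)
    where
    difference : ∀ n m → primRec (λ xs → lookup xs fzero) (λ xs → pred (lookup xs (fsuc fzero)))
                                 (n ∷ m ∷ []) ≡ m ∸ n
    difference zero    m = refl
    difference (suc n) m = trans (cong pred (difference n m)) (pred[m∸n]≡m∸[1+n] m n)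

  oneᴾ : ∀ {k} → Program X k (λ _ → 1)
  oneᴾ = comp₁ sucᴾ zeroᴾ

  pow2ᴾ : Program X 1 (unary (2 ^_))
  pow2ᴾ = cast (λ { (n ∷ []) → power n }) (primRecᴾ oneᴾ (comp₂ addᴾ x₁ x₁))
    where
    power : ∀ n → primRec {0} (λ _ → 1) (λ xs → lookup xs (fsuc fzero) + lookup xs (fsuc fzero))
                            (n ∷ []) ≡ 2 ^ n
    power zero    = refl
    power (suc n) = trans (cong (λ r → r + r) (power n)) (cong (2 ^ n +_) (sym (+-identityʳ (2 ^ n))))

  factorialᴾ : Program X 1 (unary _!)
  factorialᴾ = cast (λ { (n ∷ []) → factorial n }) (primRecᴾ oneᴾ (comp₂ mulᴾ (comp₁ sucᴾ x₀) x₁))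
    where
    factorial : ∀ n → primRec {0} (λ _ → 1) (λ xs → suc (lookup xs fzero) * lookup xs (fsuc fzero))
                                (n ∷ []) ≡ n !
    factorial zero    = refl
    factorial (suc n) = cong (suc n *_) (factorial n)

_/2^_ : ℕ → ℕ → ℕ
a /2^ L = (a / 2 ^ L) {{m^n≢0 2 L}}

_%2^_ : ℕ → ℕ → ℕ
a %2^ L = (a % 2 ^ L) {{m^n≢0 2 L}}

<*[1+/] : ∀ a n .{{_ : NonZero n}} → a < n * suc (a / n)
<*[1+/] a n = begin-strict
  a                  ≡⟨ m≡m%n+[m/n]*n a n ⟩
  a % n + a / n * n  <⟨ +-monoˡ-< _ (m%n<n a n) ⟩
  n + a / n * n      ≡⟨ *-comm (suc (a / n)) n ⟩
  n * suc (a / n)    ∎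
  where open ≤-Reasoning

<[/]⇒*[1+]≤ : ∀ a n .{{_ : NonZero n}} {z} → z < a / n → n * suc z ≤ a
<[/]⇒*[1+]≤ a n {z} z<a/n = begin
  n * suc z    ≤⟨ *-monoʳ-≤ n z<a/n ⟩
  n * (a / n)  ≡⟨ *-comm n (a / n) ⟩
  a / n * n    ≤⟨ m/n*n≤m a n ⟩
  a            ∎
  where open ≤-Reasoning

module _ {X : SetN} where

  quotientPow2ᴾ : Program X 2 (binary _/2^_)
  quotientPow2ᴾ =
    minimiseᴾ (comp₂ monusᴾ (comp₁ sucᴾ x₁) (comp₂ mulᴾ (comp₁ pow2ᴾ x₂) (comp₁ sucᴾ x₀)))
    (binary _/2^_)
    (λ { (a ∷ L ∷ []) → m≤n⇒m∸n≡0 (<*[1+/] a (2 ^ L) {{m^n≢0 2 L}}) })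
    (λ { (a ∷ L ∷ []) z<q → m>n⇒m∸n≢0 (s≤s (<[/]⇒*[1+]≤ a (2 ^ L) {{m^n≢0 2 L}} z<q)) })

  remainderPow2ᴾ : Program X 2 (binary _%2^_)
  remainderPow2ᴾ = cast (λ { (a ∷ L ∷ []) → sym (m%n≡m∸m/n*n a (2 ^ L) {{m^n≢0 2 L}}) })
    (comp₂ monusᴾ x₀ (comp₂ mulᴾ quotientPow2ᴾ (comp₁ pow2ᴾ x₁)))

mutual
  Eval-deterministic : ∀ {X k} {c : Code k} {xs y y′} → Eval X c xs y → Eval X c xs y′ → y ≡ y′
  Eval-deterministic e-zro e-zro = refl
  Eval-deterministic e-sc e-sc = refl
  Eval-deterministic e-proj e-proj = refl
  Eval-deterministic (e-comp as e) (e-comp as′ e′) with EvalAll-deterministic as as′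
  ... | refl = Eval-deterministic e e′
  Eval-deterministic (e-prec0 e) (e-prec0 e′) = Eval-deterministic e e′
  Eval-deterministic (e-precS r e) (e-precS r′ e′) with Eval-deterministic r r′
  ... | refl = Eval-deterministic e e′
  Eval-deterministic (e-mu {y = y} root below) (e-mu {y = y′} root′ below′) with <-cmp y y′
  ... | tri≈ _ y≡y′ _ = y≡y′
  ... | tri< y<y′ _ _ = ⊥-elim (0≢1+n (Eval-deterministic root (proj₂ (below′ y y<y′))))
  ... | tri> _ _ y>y′ = ⊥-elim (0≢1+n (Eval-deterministic root′ (proj₂ (below y′ y>y′))))
  Eval-deterministic e-orc e-orc = refl

  EvalAll-deterministic : ∀ {X k m} {xs : Vec ℕ k} {cs : Vec (Code k) m} {ys ys′} →
                          EvalAll X xs cs ys → EvalAll X xs cs ys′ → ys ≡ ys′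
  EvalAll-deterministic ea-[] ea-[] = refl
  EvalAll-deterministic (ea-∷ e es) (ea-∷ e′ es′) =
    cong₂ _∷_ (Eval-deterministic e e′) (EvalAll-deterministic es es′)

-- Least witnesses and factorial blocks

Least : (ℕ → Set) → ℕ → Set
Least P m = P m × (∀ {z} → z < m → ¬ P z)

least : ∀ {P : ℕ → Set} → Decidable P → ∃ P → ∃ (Least P)
least {P} P? (n , Pn) = <-rec (λ n → P n → ∃ (Least P)) search n Pn
  where
  search : ∀ n → (∀ {m} → m < n → P m → ∃ (Least P)) → P n → ∃ (Least P)
  search n smaller Pn with anyUpTo? P? n
  ... | yes (m , m<n , Pm) = smaller m<n Pm
  ... | no  none           = n , Pn , λ z<n Pz → none (_ , z<n , Pz)

!-mono-≤ : ∀ {m n} → m ≤ n → m ! ≤ n !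
!-mono-≤ {n = n} m≤n = ∣⇒≤ {{n !≢0}} (m≤n⇒m!∣n! m≤n)

n<[1+n]! : ∀ n → n < suc n !
n<[1+n]! n = m≤m*n (suc n) (n !) {{n !≢0}}

[1+n]!<[2+n]! : ∀ n → suc n ! < suc (suc n) !
[1+n]!<[2+n]! n = subst (suc n ! <_) (*-comm (suc n !) (2 + n))
  (m<m*n (suc n !) (2 + n) {{suc n !≢0}} (s≤s (s≤s z≤n)))

block-spec : ∀ x → ∃ (Least (λ y → x < suc y !))
block-spec x = least (λ y → x <? suc y !) (x , n<[1+n]! x)

opaque
  block : ℕ → ℕ
  block x = proj₁ (block-spec x)

  <[1+block]! : ∀ x → x < suc (block x) !
  <[1+block]! x = proj₁ (proj₂ (block-spec x))

  <block⇒[1+y]!≤ : ∀ {x y} → y < block x → suc y ! ≤ x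
  <block⇒[1+y]!≤ {x} y<block = ≮⇒≥ (proj₂ (proj₂ (block-spec x)) y<block)

block-≤ : ∀ {x y} → x < suc y ! → block x ≤ y
block-≤ x<[1+y]! = ≮⇒≥ λ y<block → <⇒≱ x<[1+y]! (<block⇒[1+y]!≤ y<block)

≤-block : ∀ {x l} → l ! ≤ x → l ≤ block x
≤-block {x} l!≤x = ≮⇒≥ λ block<l → <⇒≱ (<-≤-trans (<[1+block]! x) (!-mono-≤ block<l)) l!≤x

block-≤-id : ∀ x → block x ≤ x
block-≤-id x = block-≤ (n<[1+n]! x)

block-unique : ∀ {x y} → y ! ≤ x → x < suc y ! → block x ≡ y
block-unique y!≤x x<[1+y]! = ≤-antisym (block-≤ x<[1+y]!) (≤-block y!≤x)

-- Not 0 ! at 0: the block of 0 is {0}, because 0 ! = 1 ! = 1.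
blockStart : ℕ → ℕ
blockStart zero    = 0
blockStart (suc y) = suc y !

block-blockStart : ∀ y → block (blockStart y) ≡ y
block-blockStart zero    = n≤0⇒n≡0 (block-≤-id 0)
block-blockStart (suc y) = block-unique ≤-refl ([1+n]!<[2+n]! y)

≤-blockStart : ∀ y → y ≤ blockStart y
≤-blockStart zero    = z≤n
≤-blockStart (suc y) = n<[1+n]! y

module _ {X : SetN} where

  blockᴾ : Program X 1 (unary block)
  blockᴾ = minimiseᴾ (comp₂ monusᴾ (comp₁ sucᴾ x₁) (comp₁ factorialᴾ (comp₁ sucᴾ x₀))) (unary block)
    (λ { (x ∷ []) → m≤n⇒m∸n≡0 (<[1+block]! x) })
    (λ { (x ∷ []) y<block → m>n⇒m∸n≢0 (s≤s (<block⇒[1+y]!≤ y<block)) })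

  blockStartᴾ : Program X 1 (unary blockStart)
  blockStartᴾ = cast (λ { (zero ∷ []) → refl ; (suc y ∷ []) → refl })
    (primRecᴾ zeroᴾ (comp₁ factorialᴾ (comp₁ sucᴾ x₀)))

-- Canonical indices

bit-double-zero : ∀ m → bit (m * 2) 0 ≡ 0
bit-double-zero m = m*n%n≡0 m 2

bit-double-suc : ∀ m x → bit (m * 2) (suc x) ≡ bit m x
bit-double-suc m x = cong (λ n → bit n x) (m*n/n≡m m 2)

bit-double+1-zero : ∀ m → bit (1 + m * 2) 0 ≡ 1
bit-double+1-zero m = [m+kn]%n≡m%n 1 m 2

bit-double+1-suc : ∀ m x → bit (1 + m * 2) (suc x) ≡ bit m x
bit-double+1-suc m x =
  cong (λ n → bit n x) (trans (+-distrib-/-∣ʳ 1 {m * 2} {2} (divides m refl)) (m*n/n≡m m 2))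

bit-zero : ∀ x → bit 0 x ≡ 0
bit-zero zero    = refl
bit-zero (suc x) = bit-zero x

∉D-zero : ∀ {x} → ¬ x ∈D 0
∉D-zero {x} = 0≢1+n ∘ trans (sym (bit-zero x))

∈D⇒< : ∀ {x n} → x ∈D n → x < n
∈D⇒< {x}     {zero}  x∈D0 = contradiction x∈D0 (∉D-zero {x})
∈D⇒< {zero}  {suc n} _    = s≤s z≤n
∈D⇒< {suc x} {suc n} x∈Dn = ≤-<-trans (∈D⇒< {x} {suc n / 2} x∈Dn) (m/n<m (suc n) 2 (s≤s (s≤s z≤n)))

*2^[1+L] : ∀ q L → q * 2 ^ suc L ≡ q * 2 ^ L * 2
*2^[1+L] q L = trans (cong (q *_) (*-comm 2 (2 ^ L))) (sym (*-assoc q (2 ^ L) 2))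

-- 2 ^ L ∣ n says D_n ⊆ [L, ∞); the searches below test this decidable form.
2^L∣⇒∉D : ∀ {n} L {x} → 2 ^ L ∣ n → x < L → ¬ x ∈D n
2^L∣⇒∉D (suc L) {x} (divides q refl) x<1+L =
  subst (λ n → ¬ x ∈D n) (sym (*2^[1+L] q L)) (∉D-double x x<1+L)
  where
  ∉D-double : ∀ x → x < suc L → ¬ x ∈D (q * 2 ^ L * 2)
  ∉D-double zero    _         = 0≢1+n ∘ trans (sym (bit-double-zero (q * 2 ^ L)))
  ∉D-double (suc x) (s≤s x<L) =
    2^L∣⇒∉D L (divides q refl) x<L ∘ trans (sym (bit-double-suc (q * 2 ^ L) x))

n%2≡0∨1 : ∀ n → n % 2 ≡ 0 ⊎ n % 2 ≡ 1
n%2≡0∨1 n with n % 2 | m%n<n n 2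
... | 0           | _                 = inj₁ refl
... | 1           | _                 = inj₂ refl
... | suc (suc _) | s≤s (s≤s ())

∉D⇒2^L∣ : ∀ n L → (∀ {x} → x < L → ¬ x ∈D n) → 2 ^ L ∣ n
∉D⇒2^L∣ n zero    _       = divides n (sym (*-identityʳ n))
∉D⇒2^L∣ n (suc L) ∉D-below with n%2≡0∨1 n | ∉D⇒2^L∣ (n / 2) L (∉D-below ∘ s≤s)
... | inj₂ 0∈Dn | _                    = contradiction 0∈Dn (∉D-below (s≤s z≤n))
... | inj₁ n%2≡0 | divides q n/2≡q*2^L = divides q (begin
  n                  ≡⟨ m≡m%n+[m/n]*n n 2 ⟩
  n % 2 + n / 2 * 2  ≡⟨ cong₂ (λ r h → r + h * 2) n%2≡0 n/2≡q*2^L ⟩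
  q * 2 ^ L * 2      ≡⟨ *2^[1+L] q L ⟨
  q * 2 ^ suc L      ∎)
  where open ≡-Reasoning

¬2^L∣⇒∈D : ∀ {n} L → ¬ 2 ^ L ∣ n → ∃ λ x → x < L × x ∈D n
¬2^L∣⇒∈D {n} L ¬2^L∣n with anyUpTo? (λ x → bit n x ≟ 1) L
... | yes x∈Dn = x∈Dn
... | no  none = contradiction (∉D⇒2^L∣ n L (λ x<L x∈Dn → none (_ , x<L , x∈Dn))) ¬2^L∣n

-- The canonical index of [a, b).
interval : ℕ → ℕ → ℕ
interval a b = 2 ^ b ∸ 2 ^ a

interval-suc-suc : ∀ a b → interval (suc a) (suc b) ≡ interval a b * 2
interval-suc-suc a b =
  trans (cong₂ _∸_ (*-comm 2 (2 ^ b)) (*-comm 2 (2 ^ a))) (sym (*-distribʳ-∸ 2 (2 ^ b) (2 ^ a)))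

interval-zero-suc : ∀ b → interval 0 (suc b) ≡ 1 + interval 0 b * 2
interval-zero-suc b = 2*n∸1 (2 ^ b) {{m^n≢0 2 b}}
  where
  2*n∸1 : ∀ n .{{_ : NonZero n}} → 2 * n ∸ 1 ≡ 1 + (n ∸ 1) * 2
  2*n∸1 (suc p) = trans (+-suc p (p + 0)) (cong suc (*-comm 2 p))

∈interval⇒ : ∀ a b {x} → x ∈D interval a b → a ≤ x × x < b
∈interval⇒ a zero {x} x∈D rewrite m≤n⇒m∸n≡0 (m^n>0 2 a) = contradiction x∈D (∉D-zero {x})
∈interval⇒ zero (suc b) {zero} _ = z≤n , s≤s z≤n
∈interval⇒ zero (suc b) {suc x} x∈D rewrite interval-zero-suc b | bit-double+1-suc (interval 0 b) x =
  z≤n , s≤s (proj₂ (∈interval⇒ zero b x∈D))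
∈interval⇒ (suc a) (suc b) {zero} 0∈D rewrite interval-suc-suc a b | bit-double-zero (interval a b) =
  contradiction 0∈D 0≢1+n
∈interval⇒ (suc a) (suc b) {suc x} x∈D rewrite interval-suc-suc a b | bit-double-suc (interval a b) x =
  map s≤s s≤s (∈interval⇒ a b x∈D)

∈interval : ∀ {a b x} → a ≤ x → x < b → x ∈D interval a b
∈interval {zero} {suc b} {zero} _ _ rewrite interval-zero-suc b = bit-double+1-zero (interval 0 b)
∈interval {zero} {suc b} {suc x} _ (s≤s x<b)
  rewrite interval-zero-suc b | bit-double+1-suc (interval 0 b) x =
  ∈interval z≤n x<b
∈interval {suc a} {suc b} {suc x} (s≤s a≤x) (s≤s x<b)
  rewrite interval-suc-suc a b | bit-double-suc (interval a b) x =
  ∈interval a≤x x<b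

-- Pulling hyperimmunity back along block

Disjoint : (ℕ → ℕ) → Set
Disjoint f = ∀ n m → n ≢ m → ∀ x → x ∈D f n → ¬ (x ∈D f m)

disjoint⇒∃2^M∣ : ∀ {f} → Disjoint f → ∀ M → ∃ λ m → 2 ^ M ∣ f m
disjoint⇒∃2^M∣ {f} disjoint M with anyUpTo? (λ m → 2 ^ M ∣? f m) (suc M)
... | yes (m , _ , 2^M∣fm) = m , 2^M∣fm
... | no none = contradiction (pigeonhole (n<1+n M) (proj₁ ∘ low)) no-collision
  where
  low : (i : Fin (suc M)) → ∃ λ (x : Fin M) → toℕ x ∈D f (toℕ i)
  low i with ¬2^L∣⇒∈D M (λ 2^M∣ → none (toℕ i , toℕ<n i , 2^M∣))
  ... | x , x<M , x∈D = fromℕ< x<M , subst (_∈D f (toℕ i)) (sym (toℕ-fromℕ< x<M)) x∈D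
  no-collision : ¬ ∃₂ λ i j → i <ᶠ j × proj₁ (low i) ≡ proj₁ (low j)
  no-collision (i , j , i<j , same) =
    disjoint (toℕ i) (toℕ j) (<⇒≢ i<j) (toℕ (proj₁ (low i))) (proj₂ (low i))
      (subst (λ x → toℕ x ∈D f (toℕ j)) (sym same) (proj₂ (low j)))

module BlockArray {f : ℕ → ℕ} (f-array : DisjointStrongArray f) where

  firstAbove-spec : ∀ l → ∃ (Least (λ m → 2 ^ (l !) ∣ f m))
  firstAbove-spec l = least (λ m → 2 ^ (l !) ∣? f m) (disjoint⇒∃2^M∣ (proj₂ f-array) (l !))

  firstAbove : ℕ → ℕ
  firstAbove l = proj₁ (firstAbove-spec l)

  threshold : ℕ → ℕ
  threshold zero    = 0
  threshold (suc k) = suc (threshold k + f (firstAbove (threshold k)))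

  blockInterval : ℕ → ℕ
  blockInterval k = interval (threshold k) (threshold (suc k))

  block∈blockInterval : ∀ k {x} → x ∈D f (firstAbove (threshold k)) → block x ∈D blockInterval k
  block∈blockInterval k {x} x∈D = ∈interval threshold≤block block<threshold
    where
    threshold≤block : threshold k ≤ block x
    threshold≤block = ≤-block (≮⇒≥ λ x<l! →
      2^L∣⇒∉D (threshold k !) {x} (proj₁ (proj₂ (firstAbove-spec (threshold k)))) x<l! x∈D)
    block<threshold : block x < threshold (suc k)
    block<threshold =
      s≤s (≤-trans (block-≤-id x) (≤-trans (<⇒≤ (∈D⇒< {x} x∈D)) (m≤n+m _ (threshold k))))

  threshold-mono : ∀ {k k′} → k ≤ k′ → threshold k ≤ threshold k′
  threshold-mono = mono ∘ ≤⇒≤′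
    where
    mono : ∀ {k k′} → k ≤′ k′ → threshold k ≤ threshold k′
    mono ≤′-refl         = ≤-refl
    mono (≤′-step k≤k′) = ≤-trans (mono k≤k′) (m≤n⇒m≤1+n (m≤m+n _ _))

  blockInterval-disjoint : Disjoint blockInterval
  blockInterval-disjoint n m n≢m x x∈n x∈m
    with ∈interval⇒ (threshold n) _ {x} x∈n | ∈interval⇒ (threshold m) _ {x} x∈m | <-cmp n m
  ... | _ , x<tn+1 | tm≤x , _ | tri< n<m _ _ = <⇒≱ x<tn+1 (≤-trans (threshold-mono n<m) tm≤x)
  ... | _ | _ | tri≈ _ n≡m _ = n≢m n≡m
  ... | tn≤x , _ | _ , x<tm+1 | tri> _ _ m<n = <⇒≱ x<tm+1 (≤-trans (threshold-mono m<n) tn≤x)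

  fᴾ : Program ∅ 1 (unary f)
  fᴾ = fromComputable (proj₁ f-array)

  firstAboveᴾ : Program ∅ 1 (unary firstAbove)
  firstAboveᴾ = minimiseᴾ (comp₂ remainderPow2ᴾ (comp₁ fᴾ x₀) (comp₁ factorialᴾ x₁)) (unary firstAbove)
    (λ { (l ∷ []) → n∣m⇒m%n≡0 _ _ {{m^n≢0 2 (l !)}} (proj₁ (proj₂ (firstAbove-spec l))) })
    (λ { (l ∷ []) z<first →
           proj₂ (proj₂ (firstAbove-spec l)) z<first ∘ m%n≡0⇒n∣m _ _ {{m^n≢0 2 (l !)}} })

  thresholdᴾ : Program ∅ 1 (unary threshold)
  thresholdᴾ = cast (λ { (k ∷ []) → unfold k })
    (primRecᴾ zeroᴾ (comp₁ sucᴾ (comp₂ addᴾ x₁ (comp₁ fᴾ (comp₁ firstAboveᴾ x₁)))))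
    where
    unfold : ∀ k → primRec {0} (λ _ → 0)
                     (λ xs → suc (lookup xs (fsuc fzero) + f (firstAbove (lookup xs (fsuc fzero)))))
                     (k ∷ []) ≡ threshold k
    unfold zero    = refl
    unfold (suc k) = cong (λ t → suc (t + f (firstAbove t))) (unfold k)

  blockInterval-array : DisjointStrongArray blockInterval
  blockInterval-array = toComputable blockIntervalᴾ , blockInterval-disjoint
    where
    blockIntervalᴾ : Program ∅ 1 (unary blockInterval)
    blockIntervalᴾ = cast (λ { (k ∷ []) → refl })
      (comp₂ monusᴾ (comp₁ pow2ᴾ (comp₁ thresholdᴾ (comp₁ sucᴾ x₀)))
                    (comp₁ pow2ᴾ (comp₁ thresholdᴾ x₀)))

  avoids∘block : ∀ {A : SetN} → ∃[ k ] (∀ x → x ∈D blockInterval k → A x ≡ false) →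
                 ∃[ n ] (∀ x → x ∈D f n → A (block x) ≡ false)
  avoids∘block {A} (k , A∩interval≡∅) =
    firstAbove (threshold k) , λ x x∈D → A∩interval≡∅ (block x) (block∈blockInterval k x∈D)

infinite∘block : ∀ {A} → Infinite A → Infinite (A ∘ block)
infinite∘block {A} infinite m with infinite m
... | y , m≤y , y∈A =
  blockStart y , ≤-trans m≤y (≤-blockStart y) , trans (cong A (block-blockStart y)) y∈A

hyperimmune∘block : ∀ {A} → Hyperimmune A → Hyperimmune (A ∘ block)
hyperimmune∘block (infinite , avoids) = infinite∘block infinite , λ f f-array →
  BlockArray.avoids∘block f-array (avoids _ (BlockArray.blockInterval-array f-array))

CE-∘ : ∀ {A f} → CE A → Program ∅ 1 (unary f) → CE (A ∘ f)
CE-∘ {A} {f} (c , A⇔halts) fᴾ = comp c (code fᴾ ∷ []) , λ x → mk⇔ (to x) (from x)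
  where
  to : ∀ x → A (f x) ≡ true → ∃[ y ] Eval ∅ (comp c (code fᴾ ∷ [])) (x ∷ []) y
  to x fx∈A with Equivalence.to (A⇔halts (f x)) fx∈A
  ... | y , halts = y , e-comp (ea-∷ (eval fᴾ (x ∷ [])) ea-[]) halts
  from : ∀ x → ∃[ y ] Eval ∅ (comp c (code fᴾ ∷ [])) (x ∷ []) y → A (f x) ≡ true
  from x (y , e-comp (ea-∷ computes-fx ea-[]) halts) = Equivalence.from (A⇔halts (f x))
    (y , subst (λ v → Eval ∅ c (v ∷ []) y)
               (Eval-deterministic computes-fx (eval fᴾ (x ∷ []))) halts)

≗∘⇒≤T : ∀ {A B g} → Program B 1 (unary g) → A ≗ B ∘ g → A ≤T B
≗∘⇒≤T {A} {B} gᴾ A≗B∘g = comp orc (code gᴾ ∷ []) , λ x →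
  subst (λ b → Eval B (comp orc (code gᴾ ∷ [])) (x ∷ []) (bitVal b)) (sym (A≗B∘g x))
    (e-comp (ea-∷ (eval gᴾ (x ∷ [])) ea-[]) e-orc)

-- Density

count-≤ : ∀ A n → count A n ≤ n
count-≤ A zero    = z≤n
count-≤ A (suc n) with A n
... | true  = s≤s (count-≤ A n)
... | false = m≤n⇒m≤1+n (count-≤ A n)

count-stable : ∀ A {m n} → m ≤ n → (∀ {i} → m ≤ i → i < n → A i ≡ false) → count A n ≡ count A m
count-stable A = stable ∘ ≤⇒≤′
  where
  stable : ∀ {m n} → m ≤′ n → (∀ {i} → m ≤ i → i < n → A i ≡ false) → count A n ≡ count A m
  stable ≤′-refl             _      = refl
  stable (≤′-step {n} m≤′n) absent = trans
    (cong (λ b → bitVal b + count A n) (absent (≤′⇒≤ m≤′n) (n<1+n n)))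
    (stable m≤′n (λ m≤i i<n → absent m≤i (m≤n⇒m≤1+n i<n)))

count∘block-≤ : ∀ {A y} → A y ≡ false → count (A ∘ block) (suc y !) ≤ y !
count∘block-≤ {A} {y} y∉A = begin
  count (A ∘ block) (suc y !)  ≡⟨ count-stable (A ∘ block) (!-mono-≤ (n≤1+n y)) block∉A ⟩
  count (A ∘ block) (y !)      ≤⟨ count-≤ (A ∘ block) (y !) ⟩
  y !                          ∎
  where
  open ≤-Reasoning
  block∉A : ∀ {i} → y ! ≤ i → i < suc y ! → A (block i) ≡ false
  block∉A y!≤i i<[1+y]! = trans (cong A (block-unique y!≤i i<[1+y]!)) y∉A

count∘block*q<[1+p]*[1+y]! : ∀ {A y q} p → A y ≡ false → q ≤ y →
                             count (A ∘ block) (suc y !) * q < suc p * suc y !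
count∘block*q<[1+p]*[1+y]! {A} {y} {q} p y∉A q≤y = begin-strict
  count (A ∘ block) (suc y !) * q  ≤⟨ *-mono-≤ (count∘block-≤ {A} {y} y∉A) q≤y ⟩
  y ! * y                          ≡⟨ *-comm (y !) y ⟩
  y * y !                          <⟨ m<n+m (y * y !) (1≤n! y) ⟩
  suc y !                          ≤⟨ m≤n*m (suc y !) (suc p) ⟩
  suc p * suc y !                  ∎
  where open ≤-Reasoning

ρ-suc-pred<mkℚ : ∀ A D .{{_ : NonZero D}} {a d-1} .{cop : Coprime a (suc d-1)} →
                 count A D * suc d-1 < a * D → ρ-suc A (pred D) <ℚ mkℚ (ℤ.+ a) d-1 cop
ρ-suc-pred<mkℚ A (suc n) {a} {d-1} count*d<a*D =
  toℚᵘ-cancel-< (<-respˡ-≃ (≃-sym (toℚᵘ-fromℚᵘ (mkℚᵘ (ℤ.+ count A (suc n)) n)))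
    (*<*ᵘ (subst₂ ℤ._<_ (pos-* (count A (suc n)) (suc d-1)) (pos-* a (suc n)) (+<+ count*d<a*D))))

complement≡true : ∀ {A x} → complement A x ≡ true → A x ≡ false
complement≡true {A} {x} with A x
... | false = λ _ → refl
... | true  = λ ()

lowerDensityZero∘block : ∀ {A} → Infinite (complement A) → LowerDensityZero (A ∘ block)
lowerDensityZero∘block inf (mkℚ (ℤ.+ 0)      _ _) (*<* (+<+ ()))
lowerDensityZero∘block inf (mkℚ -[1+ _ ]   _ _) (*<* ())
lowerDensityZero∘block {A} inf (mkℚ (ℤ.+ suc p) d-1 _) _ N =
  let (y , N+d≤y , y∉A) = inf (N + suc d-1) in
  pred (suc y !) ,
  ≤-trans (m+n≤o⇒m≤o N N+d≤y) (<⇒≤pred (n<[1+n]! y)) ,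
  ρ-suc-pred<mkℚ (A ∘ block) (suc y !) {{suc y !≢0}}
    (count∘block*q<[1+p]*[1+y]! {A} {y} p (complement≡true {A} y∉A) (m+n≤o⇒n≤o N N+d≤y))

theorem3p2 : ∀ (C : SetN) → Hypersimple C →
    ∃[ W ] (Hypersimple W × W ≡T C × LowerDensityZero W)
theorem3p2 C (C-ce , C̄-hyperimmune@(C̄-infinite , _)) =
  C ∘ block ,
  (CE-∘ C-ce blockᴾ , hyperimmune∘block C̄-hyperimmune) ,
  (≗∘⇒≤T blockᴾ (λ _ → refl) , ≗∘⇒≤T blockStartᴾ (cong C ∘ sym ∘ block-blockStart)) ,
  lowerDensityZero∘block C̄-infinite
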